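{- Let $f:\{0,1\}^n\to\{0,1\}$ be a non-monotone Boolean function and $z\in\{0,1\}$. Then the sequence $\{\mathsf{mbs}^{z}(f^l)\}_{l\in\mathbb{N}}$ is monotone increasing (non-decreasing), and if $\mathsf{mbs}(f)\geq 2$ then for every $z\in\{0,1\}$ the sequence $\{\mathsf{mbs}^{z}(f^l)\}_{l\in\mathbb{N}}$ tends to infinity.
   Context: $f$ is monotone if it is non-decreasing or non-increasing with respect to the coordinatewise order; non-monotone means neither. Composition: $(f\circ g)(x^1,\dots,x^n)=f(g(x^1),\dots,g(x^n))$; $f^1=f$, $f^l=f\circ f^{l-1}$. For a Boolean function $h$ and input $x$, $\mathsf{mbs}(h,x)$ is the maximum number of pairwise disjoint nonempty sets $B$ of coordinates, each disjoint from $\mathrm{supp}(x)=\{i:x_i=1\}$, with $h(x^B)\ne h(x)$ ($x^B$ = $x$ with the bits in $B$ flipped). $\mathsf{mbs}(h)=\max_x\mathsf{mbs}(h,x)$ and $\mathsf{mbs}^b(h)=\max_{x\in h^{ -1}(b)}\mathsf{mbs}(h,x)$. -}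

module Defs where

open import Data.Bool using (Bool; true; false; not; if_then_else_; _≤_)
open import Data.Nat using (ℕ; zero; suc; _*_; _^_; _⊔_) renaming (_≤_ to _≤ℕ_)
open import Data.Fin using (Fin; _≟_)
open import Data.Fin.Properties using (all?; any?)
open import Data.Maybe using (Maybe; just; nothing)
import Data.Maybe.Properties as MaybeP
open import Data.Vec using (Vec; []; _∷_; lookup; zipWith; take; drop; map; head)
open import Data.List using (List; []; _∷_; foldr; upTo; allFin; concatMap; filter)
import Data.List as L
open import Data.List.Membership.Propositional using (_∈_)
open import Data.List.Membership.Propositional.Properties using (∈-map⁺; ∈-concatMap⁺)
open import Data.List.Relation.Unary.Any using (Any; here; there)
import Data.List.Relation.Unary.Any as Any
open import Data.Product using (Σ; ∃; ∃-syntax; _×_; _,_; proj₁; proj₂)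
open import Relation.Binary.PropositionalEquality using (_≡_; _≢_; refl; cong)
open import Relation.Nullary using (Dec; yes; no; does; ¬_; _×-dec_; _→-dec_; ¬?)

import Data.Bool.Properties as BoolP

-- Boolean functions on {0,1}^N, inputs as Vec Bool N (false = 0, true = 1)

BoolFun : ℕ → Set
BoolFun N = Vec Bool N → Bool

data _≤ᵥ_ : {N : ℕ} → Vec Bool N → Vec Bool N → Set where
  []  : [] ≤ᵥ []
  _∷_ : ∀ {N a b} {xs ys : Vec Bool N} → a ≤ b → xs ≤ᵥ ys → (a ∷ xs) ≤ᵥ (b ∷ ys)

NonDecreasing : {N : ℕ} → BoolFun N → Set
NonDecreasing {N} f = ∀ (x y : Vec Bool N) → x ≤ᵥ y → f x ≤ f y

NonIncreasing : {N : ℕ} → BoolFun N → Set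
NonIncreasing {N} f = ∀ (x y : Vec Bool N) → x ≤ᵥ y → f y ≤ f x

data Monotone {N : ℕ} (f : BoolFun N) : Set where
  nondec : NonDecreasing f → Monotone f
  noninc : NonIncreasing f → Monotone f

NonMonotone : {N : ℕ} → BoolFun N → Set
NonMonotone f = ¬ Monotone f

chunks : ∀ {A : Set} (n m : ℕ) → Vec A (n * m) → Vec (Vec A m) n
chunks zero    m xs = []
chunks (suc n) m xs = take m xs ∷ chunks n m (drop m xs)

_∘ᵇ_ : ∀ {n m} → BoolFun n → BoolFun m → BoolFun (n * m)
_∘ᵇ_ {n} {m} f g x = f (map g (chunks n m x))

-- iterated composition: f ^ᵇ 0 is the identity on one bit (only used as a
-- base case), f ^ᵇ 1 = f ∘ id = f, f ^ᵇ (suc l) = f ∘ f ^ᵇ l.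
_^ᵇ_ : ∀ {n} → BoolFun n → (l : ℕ) → BoolFun (n ^ l)
_^ᵇ_ f zero    x = head x
_^ᵇ_ f (suc l) = f ∘ᵇ (f ^ᵇ l)

-- Families of k pairwise disjoint blocks of coordinates, encoded as a
-- labelling c : coordinate ↦ (nothing | just j), block B_j = {i : c_i = just j}.
-- Labelled encoding makes pairwise disjointness automatic.

inBlock : ∀ {k} → Maybe (Fin k) → Fin k → Bool
inBlock m j = does (MaybeP.≡-dec _≟_ m (just j))

flipBlock : ∀ {N k} → Vec Bool N → Vec (Maybe (Fin k)) N → Fin k → Vec Bool N
flipBlock x c j = zipWith (λ b m → if inBlock m j then not b else b) x c

IsBlockFamily : ∀ {N} → BoolFun N → Vec Bool N → (k : ℕ) → Vec (Maybe (Fin k)) N → Set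
IsBlockFamily {N} h x k c =
  (∀ (j : Fin k) → ∃[ i ] lookup c i ≡ just j)
  × (∀ (i : Fin N) (j : Fin k) → lookup c i ≡ just j → lookup x i ≡ false)
  × (∀ (j : Fin k) → h (flipBlock x c j) ≢ h x)

HasBlocks : ∀ {N} → BoolFun N → Vec Bool N → ℕ → Set
HasBlocks {N} h x k = ∃[ c ] IsBlockFamily h x k c

-- Decidability (by exhaustive enumeration) so that mbs is a function.

allVecs : ∀ {A : Set} → List A → (N : ℕ) → List (Vec A N)
allVecs xs zero    = [] ∷ []
allVecs xs (suc N) = concatMap (λ a → L.map (a ∷_) (allVecs xs N)) xs

allVecs-complete : ∀ {A : Set} (xs : List A) → (∀ a → a ∈ xs) → ∀ {N} (v : Vec A N) → v ∈ allVecs xs N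
allVecs-complete xs all [] = here refl
allVecs-complete xs all (a ∷ v) =
  ∈-concatMap⁺ (λ b → L.map (b ∷_) (allVecs xs _)) (Any.map (λ { refl → ∈-map⁺ (a ∷_) (allVecs-complete xs all v) }) (all a))

allMaybeFin : (k : ℕ) → List (Maybe (Fin k))
allMaybeFin k = nothing ∷ L.map just (allFin k)

allMaybeFin-complete : ∀ {k} (m : Maybe (Fin k)) → m ∈ allMaybeFin k
allMaybeFin-complete nothing  = here refl
allMaybeFin-complete (just j) = there (∈-map⁺ just (Data.List.Membership.Propositional.Properties.∈-allFin j))

isBlockFamily? : ∀ {N} (h : BoolFun N) x k c → Dec (IsBlockFamily h x k c)
isBlockFamily? h x k c =
  all? (λ j → any? (λ i → MaybeP.≡-dec _≟_ (lookup c i) (just j)))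
  ×-dec all? (λ i → all? (λ j → MaybeP.≡-dec _≟_ (lookup c i) (just j) →-dec (lookup x i BoolP.≟ false)))
  ×-dec all? (λ j → ¬? (h (flipBlock x c j) BoolP.≟ h x))

hasBlocks? : ∀ {N} (h : BoolFun N) x k → Dec (HasBlocks h x k)
hasBlocks? {N} h x k with Any.any? (isBlockFamily? h x k) (allVecs (allMaybeFin k) N)
... | yes p = let (c , _ , q) = Data.List.Membership.Propositional.find p in yes (c , q)
... | no ¬p = no (λ { (c , q) → ¬p (Data.List.Membership.Propositional.lose
                       (allVecs-complete (allMaybeFin k) allMaybeFin-complete c) q) })

-- mbs(h,x) = max{k : HasBlocks h x k}. Any family of k nonempty disjoint
-- blocks has k ≤ N, so the maximum is taken over k ∈ {0,…,N}.

maxList : List ℕ → ℕ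
maxList = foldr _⊔_ 0

mbsAt : ∀ {N} → BoolFun N → Vec Bool N → ℕ
mbsAt {N} h x = maxList (L.map (λ k → if does (hasBlocks? h x k) then k else 0) (upTo (suc N)))

allInputs : (N : ℕ) → List (Vec Bool N)
allInputs N = allVecs (true ∷ false ∷ []) N

mbs : ∀ {N} → BoolFun N → ℕ
mbs {N} h = maxList (L.map (mbsAt h) (allInputs N))

-- mbs^b(h) = max_{x ∈ h⁻¹(b)} mbs(h,x)   (0 if h⁻¹(b) = ∅)
mbsᵇ : ∀ {N} → Bool → BoolFun N → ℕ
mbsᵇ {N} b h = maxList (L.map (mbsAt h) (filter (λ x → h x BoolP.≟ b) (allInputs N)))

module Submission where

-- If S is a family of r blocks of f at y, all inside the coordinates where y equals b, and an
-- input w of g with g w = b has k disjoint sensitive blocks inside its zeros, then feeding w to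
-- the copies of g on the coordinates in S and arbitrary g-preimages of y_i elsewhere yields an
-- input of f ∘ g of value f y with r·k disjoint sensitive blocks inside its zeros.  Hence
-- r · mbs^b(g) ≤ mbs^(f y)(f ∘ g) whenever g is onto.  A non-monotone f has a monotonicity-
-- violating edge in each direction, and the endpoints of these two edges give sensitive single
-- bits of every value at inputs of every value; with r = 1 this yields mbs^z′(g) ≤ mbs^z(f ∘ g),
-- so the sequences are non-decreasing.  If mbs(f) ≥ 2, the blocks at an optimal input give
-- mbs^0(f^(l+2)) ≥ 2 · mbs^0(f^l), which together with mbs^0(f^0) = 1 forces unbounded growth.

open import Defs
open import Data.Bool using (Bool; true; false; not; if_then_else_; f≤t; b≤b) renaming (_≤_ to _≤ᵇ_)
open import Data.Bool.Properties using (not-injective; not-¬; ¬-not) renaming (_≟_ to _≟ᵇ_; ≤-trans to ≤ᵇ-trans)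
open import Data.Nat using (ℕ; zero; suc; _+_; _*_; _≤_; _≤′_; z≤n; s≤s; ≤′-refl; ≤′-step)
open import Data.Nat.Properties using (⊔-sel; m≤m⊔n; m≤n⊔m; ≤-trans; ≤-refl; n≤1+n; m≤m+n; +-mono-≤; *-monoˡ-≤; *-zeroʳ; *-identityˡ; ≤⇒≤′)
open import Data.Fin using (Fin; zero; suc; _≟_; combine)
open import Data.Fin.Properties using (combine-surjective; combine-injectiveˡ; combine-injectiveʳ; injective⇒≤; any?)
open import Data.Maybe using (Maybe; just; nothing)
import Data.Maybe as Maybe
open import Data.Maybe.Properties using (just-injective)
open import Data.Vec using (Vec; []; _∷_; lookup; zipWith; take; drop; map; head; concat; _++_; replicate; _[_]≔_)
open import Data.Vec.Properties using (lookup-map; lookup-zipWith; lookup-replicate; lookup-concat; zipWith-++; map-∘; map-cong; map-id; lookup∘update; []≔-idempotent; []≔-lookup)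
open import Data.Vec.Relation.Binary.Pointwise.Extensional using (ext; Pointwise-≡⇒≡)
open import Data.List using ([]; _∷_; filter)
import Data.List as List
open import Data.List.Membership.Propositional using (_∈_; lose)
open import Data.List.Membership.Propositional.Properties using (∈-map⁺; ∈-filter⁺; ∈-filter⁻; ∈-upTo⁺)
open import Data.List.Relation.Unary.Any using (here; there; satisfied)
import Data.List.Relation.Unary.Any as Any
open import Data.Product using (∃-syntax; _×_; _,_; proj₁; proj₂)
open import Data.Sum using (_⊎_; inj₁; inj₂)
open import Function using (_∘_)
open import Function.Definitions using (Injective)
open import Relation.Binary.PropositionalEquality using (_≡_; _≢_; refl; cong; cong₂; sym; trans; subst; module ≡-Reasoning)
open import Relation.Nullary using (yes; no; does; ¬_; contradiction; _×-dec_)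
open import Relation.Nullary.Decidable using (dec-true; dec-false)

open ≡-Reasoning

take-++ : ∀ {A : Set} m {n} (xs : Vec A m) (ys : Vec A n) → take m (xs ++ ys) ≡ xs
take-++ zero    []       ys = refl
take-++ (suc m) (x ∷ xs) ys = cong (x ∷_) (take-++ m xs ys)

drop-++ : ∀ {A : Set} m {n} (xs : Vec A m) (ys : Vec A n) → drop m (xs ++ ys) ≡ ys
drop-++ zero    []       ys = refl
drop-++ (suc m) (x ∷ xs) ys = drop-++ m xs ys

chunks-concat : ∀ {A : Set} n m (xss : Vec (Vec A m) n) → chunks n m (concat xss) ≡ xss
chunks-concat zero    m []         = refl
chunks-concat (suc n) m (xs ∷ xss) = cong₂ _∷_
  (take-++ m xs (concat xss))
  (trans (cong (chunks n m) (drop-++ m xs (concat xss))) (chunks-concat n m xss))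

∘ᵇ-concat : ∀ {n m} (f : BoolFun n) (g : BoolFun m) (xss : Vec (Vec Bool m) n) →
  (f ∘ᵇ g) (concat xss) ≡ f (map g xss)
∘ᵇ-concat {n} {m} f g xss = cong (f ∘ map g) (chunks-concat n m xss)

flipBlock-concat : ∀ {n m k} (xss : Vec (Vec Bool m) n) (css : Vec (Vec (Maybe (Fin k)) m) n) u →
  flipBlock (concat xss) (concat css) u ≡ concat (zipWith (λ x c → flipBlock x c u) xss css)
flipBlock-concat []         []         u = refl
flipBlock-concat (x ∷ xss) (c ∷ css) u =
  trans (zipWith-++ _ x (concat xss) c (concat css))
        (cong (flipBlock x c u ++_) (flipBlock-concat xss css u))

flipBlock-unlabelled : ∀ {N k} (x : Vec Bool N) (u : Fin k) → flipBlock x (replicate N nothing) u ≡ x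
flipBlock-unlabelled []      u = refl
flipBlock-unlabelled (a ∷ x) u = cong (a ∷_) (flipBlock-unlabelled x u)

inBlock-map : ∀ {k k'} {ι : Fin k → Fin k'} → Injective _≡_ _≡_ ι →
  ∀ mc t → inBlock (Maybe.map ι mc) (ι t) ≡ inBlock mc t
inBlock-map ι-inj nothing   t = refl
inBlock-map {ι = ι} ι-inj (just t') t with t' ≟ t
... | yes refl = dec-true (ι t ≟ ι t) refl
... | no t'≢t  = dec-false (ι t' ≟ ι t) (t'≢t ∘ ι-inj)

flipBlock-relabel : ∀ {N k k'} {ι : Fin k → Fin k'} → Injective _≡_ _≡_ ι →
  ∀ (x : Vec Bool N) c t → flipBlock x (map (Maybe.map ι) c) (ι t) ≡ flipBlock x c t
flipBlock-relabel ι-inj []      []       t = refl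
flipBlock-relabel ι-inj (a ∷ x) (mc ∷ c) t = cong₂ _∷_
  (cong (λ β → if β then not a else a) (inBlock-map ι-inj mc t))
  (flipBlock-relabel ι-inj x c t)

flipBlock-relabel-outside : ∀ {N k k'} {ι : Fin k → Fin k'} {u} → (∀ t → ι t ≢ u) →
  ∀ (x : Vec Bool N) c → flipBlock x (map (Maybe.map ι) c) u ≡ x
flipBlock-relabel-outside u∉ι []      []             = refl
flipBlock-relabel-outside u∉ι (a ∷ x) (nothing ∷ c) = cong (a ∷_) (flipBlock-relabel-outside u∉ι x c)
flipBlock-relabel-outside u∉ι (a ∷ x) (just t ∷ c)  = cong₂ _∷_
  (cong (λ β → if β then not a else a) (dec-false (_ ≟ _) (u∉ι t)))
  (flipBlock-relabel-outside u∉ι x c)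

maxList-ub : ∀ {x xs} → x ∈ xs → x ≤ maxList xs
maxList-ub {x} {_ ∷ xs} (here refl) = m≤m⊔n x (maxList xs)
maxList-ub {x} {y ∷ xs} (there x∈xs) = ≤-trans (maxList-ub x∈xs) (m≤n⊔m y (maxList xs))

maxList-attained : ∀ {A : Set} (h : A → ℕ) xs →
  maxList (List.map h xs) ≡ 0 ⊎ ∃[ x ] (x ∈ xs × maxList (List.map h xs) ≡ h x)
maxList-attained h []       = inj₁ refl
maxList-attained h (x ∷ xs) with ⊔-sel (h x) (maxList (List.map h xs))
... | inj₁ e = inj₂ (x , here refl , e)
... | inj₂ e with maxList-attained h xs
...   | inj₁ e′             = inj₁ (trans e e′)
...   | inj₂ (x′ , x′∈ , e′) = inj₂ (x′ , there x′∈ , trans e e′)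

allInputs-complete : ∀ {N} (x : Vec Bool N) → x ∈ allInputs N
allInputs-complete = allVecs-complete (true ∷ false ∷ []) λ { true → here refl ; false → there (here refl) }

hasBlocks-zero : ∀ {N} (h : BoolFun N) x → HasBlocks h x 0
hasBlocks-zero {N} h x = replicate N nothing , (λ ()) , (λ _ ()) , (λ ())

blockCount≤length : ∀ {N} {h : BoolFun N} {x k c} → IsBlockFamily h x k c → k ≤ N
blockCount≤length {c = c} (nonempty , _ , _) = injective⇒≤ λ {s} {t} e →
  just-injective (trans (sym (proj₂ (nonempty s))) (trans (cong (lookup c) e) (proj₂ (nonempty t))))

mbsAt-≥ : ∀ {N} (h : BoolFun N) x k → HasBlocks h x k → k ≤ mbsAt h x
mbsAt-≥ h x k blocks@(c , family) =
  subst (λ β → (if β then k else 0) ≤ mbsAt h x) (dec-true (hasBlocks? h x k) blocks)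
    (maxList-ub (∈-map⁺ _ (∈-upTo⁺ (s≤s (blockCount≤length {h = h} {x} {c = c} family)))))

mbsAt-attained : ∀ {N} (h : BoolFun N) x → HasBlocks h x (mbsAt h x)
mbsAt-attained {N} h x with maxList-attained _ (List.upTo (suc N))
... | inj₁ e           = subst (HasBlocks h x) (sym e) (hasBlocks-zero h x)
... | inj₂ (k , _ , e) = subst (HasBlocks h x) (sym e) candidate
  where
  candidate : HasBlocks h x (if does (hasBlocks? h x k) then k else 0)
  candidate with hasBlocks? h x k
  ... | yes blocks = blocks
  ... | no _       = hasBlocks-zero h x

mbsᵇ-≥ : ∀ {N} (h : BoolFun N) {b} x → h x ≡ b → mbsAt h x ≤ mbsᵇ b h
mbsᵇ-≥ h {b} x hx≡b = maxList-ub (∈-map⁺ (mbsAt h) (∈-filter⁺ (λ x → h x ≟ᵇ b) (allInputs-complete x) hx≡b))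

mbsᵇ-attained : ∀ {N} (h : BoolFun N) b → mbsᵇ b h ≡ 0 ⊎ ∃[ x ] (h x ≡ b × mbsᵇ b h ≡ mbsAt h x)
mbsᵇ-attained {N} h b with maxList-attained (mbsAt h) (filter (λ x → h x ≟ᵇ b) (allInputs N))
... | inj₁ e            = inj₁ e
... | inj₂ (x , x∈ , e) = inj₂ (x , proj₂ (∈-filter⁻ (λ x → h x ≟ᵇ b) {xs = allInputs N} x∈) , e)

Onto : ∀ {N} → BoolFun N → Set
Onto {N} h = ∀ b → ∃[ x ] h x ≡ b

-- IsBlockFamily h x k c is, definitionally, the case b = false.
IsColouredBlockFamily : ∀ {N} → BoolFun N → Vec Bool N → Bool → (k : ℕ) → Vec (Maybe (Fin k)) N → Set
IsColouredBlockFamily {N} h x b k c =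
  (∀ (j : Fin k) → ∃[ i ] lookup c i ≡ just j)
  × (∀ (i : Fin N) (j : Fin k) → lookup c i ≡ just j → lookup x i ≡ b)
  × (∀ (j : Fin k) → h (flipBlock x c j) ≢ h x)

module Composition {n m r k} {f : BoolFun n} {g : BoolFun m} (g-onto : Onto g)
  {y b S} (S-family : IsColouredBlockFamily f y b r S)
  {w c} (gw≡b : g w ≡ b) (c-family : IsBlockFamily g w k c) where

  private
    S-coloured : ∀ i s → lookup S i ≡ just s → lookup y i ≡ b
    S-coloured = proj₁ (proj₂ S-family)

  -- y_i is replaced by w when i lies in a block of S and by a g-preimage of y_i otherwise;
  -- block s of S and block t of c together give block combine s t.
  inputChunk : Maybe (Fin r) → Bool → Vec Bool m
  inputChunk nothing  a = proj₁ (g-onto a)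
  inputChunk (just _) _ = w

  labelChunk : Maybe (Fin r) → Vec (Maybe (Fin (r * k))) m
  labelChunk nothing  = replicate m nothing
  labelChunk (just s) = map (Maybe.map (combine s)) c

  X : Vec Bool (n * m)
  X = concat (zipWith inputChunk S y)

  C : Vec (Maybe (Fin (r * k))) (n * m)
  C = concat (map labelChunk S)

  lookup-X : ∀ i q → lookup X (combine i q) ≡ lookup (inputChunk (lookup S i) (lookup y i)) q
  lookup-X i q = trans (lookup-concat (zipWith inputChunk S y) i q) (cong (λ x → lookup x q) (lookup-zipWith inputChunk i S y))

  lookup-C : ∀ i q → lookup C (combine i q) ≡ lookup (labelChunk (lookup S i)) q
  lookup-C i q = trans (lookup-concat (map labelChunk S) i q) (cong (λ x → lookup x q) (lookup-map i labelChunk S))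

  g-inputChunk : ∀ ms a → (∀ s → ms ≡ just s → a ≡ b) → g (inputChunk ms a) ≡ a
  g-inputChunk nothing  a _   = proj₂ (g-onto a)
  g-inputChunk (just s) a a≡b = trans gw≡b (sym (a≡b s refl))

  g-flipChunk : ∀ ms a s t → (∀ s′ → ms ≡ just s′ → a ≡ b) →
    g (flipBlock (inputChunk ms a) (labelChunk ms) (combine s t)) ≡ (if inBlock ms s then not a else a)
  g-flipChunk nothing a s t _ = trans (cong g (flipBlock-unlabelled _ _)) (proj₂ (g-onto a))
  g-flipChunk (just s′) a s t a≡b with s′ ≟ s
  ... | yes refl = begin
    g (flipBlock w (map (Maybe.map (combine s)) c) (combine s t))
      ≡⟨ cong g (flipBlock-relabel (combine-injectiveʳ s _ s _) w c t) ⟩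
    g (flipBlock w c t)
      ≡⟨ ¬-not (proj₂ (proj₂ c-family) t) ⟩
    not (g w)
      ≡⟨ cong not (trans gw≡b (sym (a≡b s refl))) ⟩
    not a ∎
  ... | no s′≢s = begin
    g (flipBlock w (map (Maybe.map (combine s′)) c) (combine s t))
      ≡⟨ cong g (flipBlock-relabel-outside (λ t′ e → s′≢s (combine-injectiveˡ s′ t′ s t e)) w c) ⟩
    g w
      ≡⟨ trans gw≡b (sym (a≡b s′ refl)) ⟩
    a ∎

  X-value : (f ∘ᵇ g) X ≡ f y
  X-value = trans (∘ᵇ-concat f g (zipWith inputChunk S y)) (cong f (Pointwise-≡⇒≡ (ext λ i → begin
    lookup (map g (zipWith inputChunk S y)) i     ≡⟨ lookup-map i g (zipWith inputChunk S y) ⟩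
    g (lookup (zipWith inputChunk S y) i)         ≡⟨ cong g (lookup-zipWith inputChunk i S y) ⟩
    g (inputChunk (lookup S i) (lookup y i))      ≡⟨ g-inputChunk (lookup S i) (lookup y i) (S-coloured i) ⟩
    lookup y i                                    ∎)))

  X-flipped : ∀ s t → (f ∘ᵇ g) (flipBlock X C (combine s t)) ≡ f (flipBlock y S s)
  X-flipped s t = begin
    (f ∘ᵇ g) (flipBlock X C u)                    ≡⟨ cong (f ∘ᵇ g) (flipBlock-concat xss css u) ⟩
    (f ∘ᵇ g) (concat (zipWith flipChunk xss css)) ≡⟨ ∘ᵇ-concat f g (zipWith flipChunk xss css) ⟩
    f (map g (zipWith flipChunk xss css))         ≡⟨ cong f (Pointwise-≡⇒≡ (ext pointwise)) ⟩
    f (flipBlock y S s)                           ∎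
    where
    u = combine s t
    xss = zipWith inputChunk S y
    css = map labelChunk S
    flipChunk : Vec Bool m → Vec (Maybe (Fin (r * k))) m → Vec Bool m
    flipChunk x c′ = flipBlock x c′ u
    pointwise : ∀ i → lookup (map g (zipWith flipChunk xss css)) i ≡ lookup (flipBlock y S s) i
    pointwise i = begin
      lookup (map g (zipWith flipChunk xss css)) i
        ≡⟨ lookup-map i g (zipWith flipChunk xss css) ⟩
      g (lookup (zipWith flipChunk xss css) i)
        ≡⟨ cong g (lookup-zipWith flipChunk i xss css) ⟩
      g (flipChunk (lookup xss i) (lookup css i))
        ≡⟨ cong₂ (λ x c′ → g (flipChunk x c′)) (lookup-zipWith inputChunk i S y) (lookup-map i labelChunk S) ⟩
      g (flipChunk (inputChunk (lookup S i) (lookup y i)) (labelChunk (lookup S i)))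
        ≡⟨ g-flipChunk (lookup S i) (lookup y i) s t (S-coloured i) ⟩
      (if inBlock (lookup S i) s then not (lookup y i) else lookup y i)
        ≡⟨ lookup-zipWith _ i y S ⟨
      lookup (flipBlock y S s) i ∎

  C-nonempty : ∀ u → ∃[ v ] lookup C v ≡ just u
  C-nonempty u with combine-surjective {r} {k} u
  ... | s , t , refl with proj₁ S-family s | proj₁ c-family t
  ...   | i , Si≡s | q , cq≡t = combine i q , (begin
    lookup C (combine i q)                    ≡⟨ lookup-C i q ⟩
    lookup (labelChunk (lookup S i)) q        ≡⟨ cong (λ ms → lookup (labelChunk ms) q) Si≡s ⟩
    lookup (map (Maybe.map (combine s)) c) q  ≡⟨ lookup-map q _ c ⟩
    Maybe.map (combine s) (lookup c q)        ≡⟨ cong (Maybe.map (combine s)) cq≡t ⟩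
    just (combine s t)                        ∎)

  labelChunk-support : ∀ ms a q u → lookup (labelChunk ms) q ≡ just u → lookup (inputChunk ms a) q ≡ false
  labelChunk-support nothing a q u e with () ← trans (sym (lookup-replicate q nothing)) e
  labelChunk-support (just s) a q u e with lookup c q in cq≡ | lookup-map q (Maybe.map (combine s)) c
  ... | just t  | _  = proj₁ (proj₂ c-family) q t cq≡
  ... | nothing | e′ with () ← trans (sym e′) e

  C-support : ∀ v u → lookup C v ≡ just u → lookup X v ≡ false
  C-support v u e with combine-surjective {n} {m} v
  ... | i , q , refl = trans (lookup-X i q) (labelChunk-support (lookup S i) (lookup y i) q u (trans (sym (lookup-C i q)) e))

  C-sensitive : ∀ u → (f ∘ᵇ g) (flipBlock X C u) ≢ (f ∘ᵇ g) X
  C-sensitive u with combine-surjective {r} {k} u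
  ... | s , t , refl = λ e → proj₂ (proj₂ S-family) s (trans (sym (X-flipped s t)) (trans e X-value))

  C-family : IsBlockFamily (f ∘ᵇ g) X (r * k) C
  C-family = C-nonempty , C-support , C-sensitive

mbsᵇ-∘ᵇ-≥ : ∀ {n m r} (f : BoolFun n) {g : BoolFun m} → Onto g →
  ∀ {b} y S → IsColouredBlockFamily f y b r S → r * mbsᵇ b g ≤ mbsᵇ (f y) (f ∘ᵇ g)
mbsᵇ-∘ᵇ-≥ {r = r} f {g} g-onto {b} y S S-family with mbsᵇ-attained g b
... | inj₁ e rewrite e | *-zeroʳ r = z≤n
... | inj₂ (w , gw≡b , e) rewrite e =
  ≤-trans (mbsAt-≥ (f ∘ᵇ g) X _ (C , C-family)) (mbsᵇ-≥ (f ∘ᵇ g) X X-value)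
  where open Composition {f = f} g-onto {y = y} {S = S} S-family gw≡b (proj₂ (mbsAt-attained g w))

singleBlock : ∀ {n} → Fin n → Vec (Maybe (Fin 1)) n
singleBlock {suc n} zero    = just zero ∷ replicate n nothing
singleBlock         (suc p) = nothing ∷ singleBlock p

lookup-singleBlock-self : ∀ {n} (p : Fin n) → lookup (singleBlock p) p ≡ just zero
lookup-singleBlock-self zero    = refl
lookup-singleBlock-self (suc p) = lookup-singleBlock-self p

lookup-singleBlock : ∀ {n} (p i : Fin n) {s} → lookup (singleBlock p) i ≡ just s → i ≡ p
lookup-singleBlock zero    zero    e = refl
lookup-singleBlock zero    (suc i) e with () ← trans (sym (lookup-replicate i nothing)) e
lookup-singleBlock (suc p) (suc i) e = cong suc (lookup-singleBlock p i e)

flipBlock-singleBlock : ∀ {n} (y : Vec Bool n) p → flipBlock y (singleBlock p) zero ≡ y [ p ]≔ not (lookup y p)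
flipBlock-singleBlock (a ∷ y) zero    = cong (not a ∷_) (flipBlock-unlabelled y zero)
flipBlock-singleBlock (a ∷ y) (suc p) = cong (a ∷_) (flipBlock-singleBlock y p)

Sensitive : ∀ {n} → BoolFun n → Vec Bool n → Fin n → Set
Sensitive f y p = f (y [ p ]≔ not (lookup y p)) ≢ f y

sensitive⇒colouredBlockFamily : ∀ {n} (f : BoolFun n) y p → Sensitive f y p →
  IsColouredBlockFamily f y (lookup y p) 1 (singleBlock p)
sensitive⇒colouredBlockFamily f y p sensitive =
  (λ { zero → p , lookup-singleBlock-self p }) ,
  (λ i _ e → cong (lookup y) (lookup-singleBlock p i e)) ,
  (λ { zero → sensitive ∘ trans (cong f (sym (flipBlock-singleBlock y p))) })

HasSensitiveBit : ∀ {n} → BoolFun n → Bool → Bool → Set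
HasSensitiveBit f z z′ = ∃[ y ] ∃[ p ] (f y ≡ z × lookup y p ≡ z′ × Sensitive f y p)

Edge : ∀ {n} → BoolFun n → Bool → Set
Edge f a = ∃[ v ] ∃[ p ] (lookup v p ≡ false × f v ≡ a × f (v [ p ]≔ true) ≡ not a)

edge⇒sensitiveBits : ∀ {n} {f : BoolFun n} {a} → Edge f a → HasSensitiveBit f a false × HasSensitiveBit f (not a) true
edge⇒sensitiveBits {f = f} {a} (v , p , vp≡false , fv≡a , fv′≡¬a) =
  (v  , p , fv≡a   , vp≡false                , λ e → fv≢fv′ (trans (sym e) (cong (λ β → f (v [ p ]≔ not β)) vp≡false))) ,
  (v′ , p , fv′≡¬a , lookup∘update p v true , λ e → fv≢fv′ (trans (cong f (sym back)) e))
  where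
  v′ = v [ p ]≔ true
  fv≢fv′ : f v ≢ f v′
  fv≢fv′ e = not-¬ refl (trans (sym fv≡a) (trans e fv′≡¬a))
  back : v′ [ p ]≔ not (lookup v′ p) ≡ v
  back = begin
    v′ [ p ]≔ not (lookup v′ p) ≡⟨ cong (λ β → v′ [ p ]≔ not β) (lookup∘update p v true) ⟩
    v′ [ p ]≔ false             ≡⟨ []≔-idempotent v p ⟩
    v [ p ]≔ false              ≡⟨ cong (v [ p ]≔_) vp≡false ⟨
    v [ p ]≔ lookup v p         ≡⟨ []≔-lookup v p ⟩
    v                           ∎

noEdge⇒nonIncreasing : ∀ {N} (f : BoolFun N) → (∀ v p → lookup v p ≡ false → f (v [ p ]≔ true) ≤ᵇ f v) → NonIncreasing f
noEdge⇒nonIncreasing f up≤ [] [] [] = b≤b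
noEdge⇒nonIncreasing f up≤ (a ∷ x) (b ∷ y) (a≤b ∷ x≤y) =
  ≤ᵇ-trans (noEdge⇒nonIncreasing (λ v → f (b ∷ v)) (λ v p → up≤ (b ∷ v) (suc p)) x y x≤y) (head-step a≤b)
  where
  head-step : a ≤ᵇ b → f (b ∷ x) ≤ᵇ f (a ∷ x)
  head-step b≤b = b≤b
  head-step f≤t = up≤ (false ∷ x) zero refl

¬nonIncreasing⇒edge : ∀ {n} (f : BoolFun n) → ¬ NonIncreasing f → Edge f false
¬nonIncreasing⇒edge {n} f ¬nonInc
  with Any.any? (λ v → any? λ p → lookup v p ≟ᵇ false ×-dec f v ≟ᵇ false ×-dec f (v [ p ]≔ true) ≟ᵇ true) (allInputs n)
... | yes found = satisfied found
... | no none = contradiction (noEdge⇒nonIncreasing f up≤) ¬nonInc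
  where
  up≤ : ∀ v p → lookup v p ≡ false → f (v [ p ]≔ true) ≤ᵇ f v
  up≤ v p vp≡false with f v in fv | f (v [ p ]≔ true) in fv′
  ... | true  | true  = b≤b
  ... | true  | false = f≤t
  ... | false | false = b≤b
  ... | false | true  = contradiction (lose (allInputs-complete v) (p , vp≡false , fv , fv′)) none

not-≤-reflect : ∀ {a b} → not a ≤ᵇ not b → b ≤ᵇ a
not-≤-reflect {false} {false} _ = b≤b
not-≤-reflect {true}  {false} _ = f≤t
not-≤-reflect {true}  {true}  _ = b≤b

¬nonDecreasing⇒edge : ∀ {n} (f : BoolFun n) → ¬ NonDecreasing f → Edge f true
¬nonDecreasing⇒edge f ¬nonDec with ¬nonIncreasing⇒edge (not ∘ f) (λ nonInc → ¬nonDec λ x y x≤y → not-≤-reflect (nonInc x y x≤y))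
... | v , p , vp≡false , ¬fv≡false , ¬fv′≡true = v , p , vp≡false , not-injective ¬fv≡false , not-injective ¬fv′≡true

nonMonotone⇒sensitiveBit : ∀ {n} (f : BoolFun n) → NonMonotone f → ∀ z z′ → HasSensitiveBit f z z′
nonMonotone⇒sensitiveBit f nonMono false false = proj₁ (edge⇒sensitiveBits (¬nonIncreasing⇒edge f (nonMono ∘ noninc)))
nonMonotone⇒sensitiveBit f nonMono true  true  = proj₂ (edge⇒sensitiveBits (¬nonIncreasing⇒edge f (nonMono ∘ noninc)))
nonMonotone⇒sensitiveBit f nonMono true  false = proj₁ (edge⇒sensitiveBits (¬nonDecreasing⇒edge f (nonMono ∘ nondec)))
nonMonotone⇒sensitiveBit f nonMono false true  = proj₂ (edge⇒sensitiveBits (¬nonDecreasing⇒edge f (nonMono ∘ nondec)))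

nonMonotone⇒onto : ∀ {n} (f : BoolFun n) → NonMonotone f → Onto f
nonMonotone⇒onto f nonMono z = let y , _ , fy≡z , _ = nonMonotone⇒sensitiveBit f nonMono z false in y , fy≡z

∘ᵇ-onto : ∀ {n m} {f : BoolFun n} {g : BoolFun m} → Onto f → Onto g → Onto (f ∘ᵇ g)
∘ᵇ-onto {f = f} {g} f-onto g-onto b = concat (map preimage y) , (begin
  (f ∘ᵇ g) (concat (map preimage y)) ≡⟨ ∘ᵇ-concat f g (map preimage y) ⟩
  f (map g (map preimage y))         ≡⟨ cong f (map-∘ g preimage y) ⟨
  f (map (g ∘ preimage) y)           ≡⟨ cong f (trans (map-cong (proj₂ ∘ g-onto) y) (map-id y)) ⟩
  f y                                ≡⟨ fy≡b ⟩
  b                                  ∎)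
  where
  y = proj₁ (f-onto b)
  fy≡b = proj₂ (f-onto b)
  preimage : Bool → Vec Bool _
  preimage a = proj₁ (g-onto a)

^ᵇ-onto : ∀ {n} (f : BoolFun n) → NonMonotone f → ∀ l → Onto (f ^ᵇ l)
^ᵇ-onto f nonMono zero    b = (b ∷ []) , refl
^ᵇ-onto f nonMono (suc l)   = ∘ᵇ-onto (nonMonotone⇒onto f nonMono) (^ᵇ-onto f nonMono l)

nonMonotone⇒mbsᵇ-∘ᵇ-≥ : ∀ {n m} (f : BoolFun n) {g : BoolFun m} → NonMonotone f → Onto g →
  ∀ z z′ → mbsᵇ z′ g ≤ mbsᵇ z (f ∘ᵇ g)
nonMonotone⇒mbsᵇ-∘ᵇ-≥ f {g} nonMono g-onto z z′ with nonMonotone⇒sensitiveBit f nonMono z z′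
... | y , p , refl , refl , sensitive =
  subst (_≤ mbsᵇ (f y) (f ∘ᵇ g)) (*-identityˡ _) (mbsᵇ-∘ᵇ-≥ f g-onto y (singleBlock p) (sensitive⇒colouredBlockFamily f y p sensitive))

mbs≥2⇒doubling : ∀ {n} (f : BoolFun n) → 2 ≤ mbs f →
  ∃[ b ] ∀ {m} {g : BoolFun m} → Onto g → 2 * mbsᵇ false g ≤ mbsᵇ b (f ∘ᵇ g)
mbs≥2⇒doubling {n} f 2≤mbs with maxList-attained (mbsAt f) (allInputs n)
... | inj₁ mbs≡0 with () ← subst (2 ≤_) mbs≡0 2≤mbs
... | inj₂ (x , _ , mbs≡) = f x , λ g-onto →
  ≤-trans (*-monoˡ-≤ _ (subst (2 ≤_) mbs≡ 2≤mbs)) (mbsᵇ-∘ᵇ-≥ f g-onto x _ (proj₂ (mbsAt-attained f x)))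

1≤mbsᵇ-head : 1 ≤ mbsᵇ false (head {A = Bool} {n = 0})
1≤mbsᵇ-head = ≤-trans (mbsAt-≥ head x 1 (singleBlock zero , sensitive⇒colouredBlockFamily head x zero λ ()))
                      (mbsᵇ-≥ head x refl)
  where x = false ∷ []

nondecreasing-≤′ : (a : ℕ → ℕ) → (∀ l → a l ≤ a (suc l)) → ∀ {L l} → L ≤′ l → a L ≤ a l
nondecreasing-≤′ a step ≤′-refl        = ≤-refl
nondecreasing-≤′ a step (≤′-step L≤′l) = ≤-trans (nondecreasing-≤′ a step L≤′l) (step _)

doubling⇒unbounded : (a : ℕ → ℕ) → (∀ l → a l ≤ a (suc l)) → 1 ≤ a 0 → (∀ l → 2 * a l ≤ a (2 + l)) →
  ∀ k → ∃[ L ] ∀ l → L ≤ l → k ≤ a l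
doubling⇒unbounded a step 1≤a₀ double k =
  let L , k<aL = reach k in L , λ l L≤l → ≤-trans (n≤1+n k) (≤-trans k<aL (nondecreasing-≤′ a step (≤⇒≤′ L≤l)))
  where
  reach : ∀ k → ∃[ L ] suc k ≤ a L
  reach zero    = 0 , 1≤a₀
  reach (suc k) = let L , k<aL = reach k in
    2 + L , ≤-trans (+-mono-≤ (≤-trans (s≤s z≤n) k<aL) (≤-trans k<aL (m≤m+n _ 0))) (double L)

corollary2 : ∀ {n : ℕ} (f : BoolFun n) → NonMonotone f →
    (∀ (z : Bool) (l : ℕ) → 1 ≤ l → mbsᵇ z (f ^ᵇ l) ≤ mbsᵇ z (f ^ᵇ suc l))
    × (2 ≤ mbs f → ∀ (z : Bool) (k : ℕ) → ∃[ L ] (∀ (l : ℕ) → L ≤ l → k ≤ mbsᵇ z (f ^ᵇ l)))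
corollary2 f nonMono = (λ z l _ → step z z l) , unbounded
  where
  -- holds from l = 0 on
  step : ∀ z z′ l → mbsᵇ z′ (f ^ᵇ l) ≤ mbsᵇ z (f ^ᵇ suc l)
  step z z′ l = nonMonotone⇒mbsᵇ-∘ᵇ-≥ f nonMono (^ᵇ-onto f nonMono l) z z′

  a : ℕ → ℕ
  a l = mbsᵇ false (f ^ᵇ l)

  unbounded : 2 ≤ mbs f → ∀ z k → ∃[ L ] (∀ l → L ≤ l → k ≤ mbsᵇ z (f ^ᵇ l))
  unbounded 2≤mbs z k with mbs≥2⇒doubling f 2≤mbs
  ... | b , doubles with doubling⇒unbounded a (step false false) 1≤mbsᵇ-head double k
    where
    double : ∀ l → 2 * a l ≤ a (2 + l)
    double l = ≤-trans (doubles (^ᵇ-onto f nonMono l)) (step false b (suc l))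
  ... | L , k≤a = suc L , λ { zero () ; (suc l) (s≤s L≤l) → ≤-trans (k≤a l L≤l) (step z false l) }
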